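{- For every $n\ge 1$: (i) $\mathcal{DRS}_n(312)=\mathcal{RS}_n(312)$; (ii) the map $\sigma\mapsto\sigma^{ -1}$ is a bijection from $\mathcal{DRS}_n(312)$ onto $\mathcal{DRS}_n(231)$.
   Context: For $\sigma\in\mathfrak{S}_n$, a double descent is an index $i$ with $\sigma_i>\sigma_{i+1}>\sigma_{i+2}$. The permutation $\sigma$ is simsun if for every $k$, the subword of $\sigma$ consisting of the letters in $\{1,\dots,k\}$ (in the order they appear in $\sigma$) has no double descent. For $\omega\in\mathfrak{S}_t$, $\sigma$ contains an $\omega$-pattern if there are indices $i_1<\cdots<i_t$ with $\sigma_{i_j}<\sigma_{i_k}$ iff $\omega_j<\omega_k$; otherwise $\sigma$ avoids $\omega$. $\mathcal{RS}_n(\omega)$ is the set of $\omega$-avoiding simsun permutations in $\mathfrak{S}_n$, and $\mathcal{DRS}_n(\omega)$ is the set of $\sigma\in\mathcal{RS}_n(\omega)$ such that $\sigma^{ -1}$ is simsun (no avoidance condition is imposed on $\sigma^{ -1}$). -}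

module Defs where

open import Data.Nat using (ℕ; suc; _<_; _<ᵇ_)
open import Data.Fin using (Fin; toℕ)
import Data.Fin as F
open import Data.Fin.Permutation using (Permutation′; _⟨$⟩ʳ_; flip)
open import Data.List using (List; []; _∷_; filterᵇ; tabulate)
open import Data.Vec using (Vec; lookup) renaming ([] to []ᵛ; _∷_ to _∷ᵛ_)
open import Data.Product using (_×_; ∃)
open import Relation.Nullary using (¬_)
open import Function.Bundles using (_⇔_)

-- A permutation of [n] is a bijection Fin n ↔ Fin n;
-- the value σ_i (1-based) is 1 + toℕ (σ ⟨$⟩ʳ i).
Perm : ℕ → Set
Perm = Permutation′

word : ∀ {n} → Perm n → List ℕ
word {n} σ = tabulate (λ i → suc (toℕ (σ ⟨$⟩ʳ i)))

inv : ∀ {n} → Perm n → Perm n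
inv = flip

data HasDoubleDescent : List ℕ → Set where
  here  : ∀ {a b c w} → b < a → c < b → HasDoubleDescent (a ∷ b ∷ c ∷ w)
  there : ∀ {a w} → HasDoubleDescent w → HasDoubleDescent (a ∷ w)

restrict : ℕ → List ℕ → List ℕ
restrict k = filterᵇ (λ x → x <ᵇ suc k)

Simsun : ∀ {n} → Perm n → Set
Simsun σ = ∀ (k : ℕ) → ¬ HasDoubleDescent (restrict k (word σ))

-- σ contains the pattern ω ∈ 𝔖_t (ω given by its one-line values)
Contains : ∀ {n t} → Perm n → (Fin t → ℕ) → Set
Contains {n} {t} σ ω =
  ∃ λ (ι : Fin t → Fin n) →
    (∀ j k → j F.< k → ι j F.< ι k) ×
    (∀ j k → ((σ ⟨$⟩ʳ ι j) F.< (σ ⟨$⟩ʳ ι k)) ⇔ (ω j < ω k))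

Avoids : ∀ {n t} → Perm n → (Fin t → ℕ) → Set
Avoids σ ω = ¬ Contains σ ω

p312 : Fin 3 → ℕ
p312 = lookup (3 ∷ᵛ 1 ∷ᵛ 2 ∷ᵛ []ᵛ)

p231 : Fin 3 → ℕ
p231 = lookup (2 ∷ᵛ 3 ∷ᵛ 1 ∷ᵛ []ᵛ)

RS : ∀ {n t} → (Fin t → ℕ) → Perm n → Set
RS ω σ = Simsun σ × Avoids σ ω

DRS : ∀ {n t} → (Fin t → ℕ) → Perm n → Set
DRS ω σ = RS ω σ × Simsun (inv σ)

_≈ₚ_ : ∀ {n} → Perm n → Perm n → Set
σ ≈ₚ τ = ∀ i → σ ⟨$⟩ʳ i ≡ τ ⟨$⟩ʳ i
  where open import Relation.Binary.PropositionalEquality using (_≡_)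

module Submission where

-- The heart of (i) is that a 312-avoiding simsun permutation has a simsun
-- inverse.  Choosing k minimal,
-- σ fails to be simsun iff it has an Obstruction: positions P < Q < R with
-- σ(P) > σ(Q) > σ(R) and every other position between P and R carrying a value
-- above σ(P).  An obstruction of σ⁻¹, read through σ, yields an obstruction of
-- σ unless σ contains 312 (obstruction-inverse).  For (ii), an occurrence of
-- 312 in σ is an occurrence of 231 in σ⁻¹ and conversely, and inversion is an
-- involution, hence injective and onto.

open import Defs
open import Data.Nat using (ℕ; _≥_)
open import Data.Product using (_×_; ∃)
open import Function.Bundles using (_⇔_)

open import Data.Bool using (Bool; true; false; T)
open import Data.Empty using (⊥-elim)
open import Data.Fin using (Fin; zero; suc; toℕ) renaming (_<_ to _<ᶠ_)
open import Data.Fin.Properties using (<⇒≢)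
  renaming (<-cmp to <ᶠ-cmp; <-trans to <ᶠ-trans; <-asym to <ᶠ-asym; <-irrefl to <ᶠ-irrefl)
open import Data.Fin.Permutation using (_⟨$⟩ʳ_; _⟨$⟩ˡ_; inverseˡ; inverseʳ)
open import Data.List using (_∷_; filterᵇ; tabulate)
open import Data.List.Properties using (∷-injective)
open import Data.Nat using (zero; suc; _<_; _≤_; _<ᵇ_; _≤ᵇ_; z<s; s≤s; s≤s⁻¹)
open import Data.Nat.Properties using (<-cmp; ≤-refl; ≤-trans; <⇒≤; <⇒≱; ≮⇒≥; <ᵇ⇒<; <⇒<ᵇ; ≤ᵇ⇒≤)
open import Data.Product using (_,_; proj₁; proj₂; ∃₂)
open import Data.Sum using (_⊎_; inj₁; inj₂)
open import Function using (_∘_)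
open import Function.Bundles using (mk⇔; Equivalence)
open import Relation.Binary.Definitions using (tri<; tri≈; tri>)
open import Relation.Binary.PropositionalEquality
  using (_≡_; _≢_; refl; sym; trans; cong; subst; subst₂; module ≡-Reasoning)
open import Relation.Nullary using (¬_)

dd-cons : ∀ {a L} → HasDoubleDescent (a ∷ L) →
  HasDoubleDescent L ⊎ ∃₂ λ b c → ∃ λ L′ → L ≡ b ∷ c ∷ L′ × b < a × c < b
dd-cons (here b<a c<b) = inj₂ (_ , _ , _ , refl , b<a , c<b)
dd-cons (there h)      = inj₁ h

module Kept (p : ℕ → Bool) where

  kept : ∀ {x} → p x ≡ true → T (p x)
  kept e = subst T (sym e) _

  dropped : ∀ {x} → p x ≡ false → ¬ T (p x)
  dropped e = subst T e

  record First {n} (g : Fin n → ℕ) (j : Fin n) : Set where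
    constructor first
    field
      keptJ  : T (p (g j))
      before : ∀ x → x <ᶠ j → ¬ T (p (g x))

  record Next {n} (g : Fin n → ℕ) (i j : Fin n) : Set where
    constructor next
    field
      i<j     : i <ᶠ j
      keptJ   : T (p (g j))
      between : ∀ x → i <ᶠ x → x <ᶠ j → ¬ T (p (g x))

  module _ {n} {g : Fin (suc n) → ℕ} where

    first-suc : ∀ {j} → ¬ T (p (g zero)) → First (g ∘ suc) j → First g (suc j)
    first-suc ¬p0 (first pj before) =
      first pj λ { zero _ → ¬p0 ; (suc x) (s≤s x<j) → before x x<j }

    first-pred : ∀ {j} → First g (suc j) → First (g ∘ suc) j
    first-pred (first pj before) = first pj λ x x<j → before (suc x) (s≤s x<j)

    next-suc : ∀ {i j} → Next (g ∘ suc) i j → Next g (suc i) (suc j)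
    next-suc (next i<j pj between) =
      next (s≤s i<j) pj λ { zero () ; (suc x) (s≤s i<x) (s≤s x<j) → between x i<x x<j }

    next-pred : ∀ {i j} → Next g (suc i) (suc j) → Next (g ∘ suc) i j
    next-pred (next (s≤s i<j) pj between) =
      next i<j pj λ x i<x x<j → between (suc x) (s≤s i<x) (s≤s x<j)

    first⇒next-zero : ∀ {j} → First (g ∘ suc) j → Next g zero (suc j)
    first⇒next-zero (first pj before) =
      next z<s pj λ { zero () ; (suc x) _ (s≤s x<j) → before x x<j }

    next-zero⇒first : ∀ {j} → Next g zero (suc j) → First (g ∘ suc) j
    next-zero⇒first (next _ pj between) = first pj λ x x<j → between (suc x) z<s (s≤s x<j)

  filter-first : ∀ {n} (g : Fin n → ℕ) {j} → First g j →
    ∃ λ L → filterᵇ p (tabulate g) ≡ g j ∷ L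
  filter-first g {zero} (first pj _) with p (g zero)
  ... | true  = _ , refl
  ... | false = ⊥-elim pj
  filter-first g {suc j} f@(first _ before) with p (g zero) | before zero z<s
  ... | false | _   = filter-first (g ∘ suc) (first-pred f)
  ... | true  | ¬p0 = ⊥-elim (¬p0 _)

  filter-first-next : ∀ {n} (g : Fin n → ℕ) {i j} → First g i → Next g i j →
    ∃ λ L → filterᵇ p (tabulate g) ≡ g i ∷ g j ∷ L
  filter-first-next g {zero} {suc j} (first pi _) nij with p (g zero)
  ... | true  = let L , eq = filter-first (g ∘ suc) (next-zero⇒first nij) in L , cong (g zero ∷_) eq
  ... | false = ⊥-elim pi
  filter-first-next g {suc i} {suc j} fi@(first _ before) nij with p (g zero) | before zero z<s
  ... | false | _   = filter-first-next (g ∘ suc) (first-pred fi) (next-pred nij)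
  ... | true  | ¬p0 = ⊥-elim (¬p0 _)
  filter-first-next g {zero}  {zero} _ (next () _ _)
  filter-first-next g {suc _} {zero} _ (next () _ _)

  first-of-filter : ∀ {n} (g : Fin n → ℕ) {b L} → filterᵇ p (tabulate g) ≡ b ∷ L →
    ∃ λ j → First g j × g j ≡ b
  first-of-filter {suc n} g eq with p (g zero) in e
  ... | true  = zero , first (kept e) (λ _ ()) , proj₁ (∷-injective eq)
  ... | false = let j , fj , gj = first-of-filter (g ∘ suc) eq in suc j , first-suc (dropped e) fj , gj

  first-next-of-filter : ∀ {n} (g : Fin n → ℕ) {b c L} → filterᵇ p (tabulate g) ≡ b ∷ c ∷ L →
    ∃₂ λ i j → First g i × Next g i j × g i ≡ b × g j ≡ c
  first-next-of-filter {suc n} g eq with p (g zero) in e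
  ... | true  = let j , fj , gj = first-of-filter (g ∘ suc) (proj₂ (∷-injective eq))
                in zero , suc j , first (kept e) (λ _ ()) , first⇒next-zero fj , proj₁ (∷-injective eq) , gj
  ... | false = let i , j , fi , nij , gi , gj = first-next-of-filter (g ∘ suc) eq
                in suc i , suc j , first-suc (dropped e) fi , next-suc nij , gi , gj

  record Descent {n} (g : Fin n → ℕ) : Set where
    constructor descent
    field
      P Q R : Fin n
      keptP : T (p (g P))
      nextQ : Next g P Q
      nextR : Next g Q R
      descQ : g Q < g P
      descR : g R < g Q

  descent-suc : ∀ {n} {g : Fin (suc n) → ℕ} → Descent (g ∘ suc) → Descent g
  descent-suc (descent P Q R kP nQ nR dQ dR) =
    descent (suc P) (suc Q) (suc R) kP (next-suc nQ) (next-suc nR) dQ dR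

  descent-of-dd : ∀ {n} (g : Fin n → ℕ) → HasDoubleDescent (filterᵇ p (tabulate g)) → Descent g
  descent-of-dd {zero} g ()
  descent-of-dd {suc n} g h with p (g zero) in e
  ... | false = descent-suc (descent-of-dd (g ∘ suc) h)
  ... | true with dd-cons h
  ...   | inj₁ h′ = descent-suc (descent-of-dd (g ∘ suc) h′)
  ...   | inj₂ (_ , _ , _ , eq , b<a , c<b) =
          let i , j , fi , nij , gi , gj = first-next-of-filter (g ∘ suc) eq
          in descent zero (suc i) (suc j) (kept e) (first⇒next-zero fi) (next-suc nij)
                     (subst (_< g zero) (sym gi) b<a) (subst₂ _<_ (sym gj) (sym gi) c<b)

  keep-there : ∀ x {w} → HasDoubleDescent (filterᵇ p w) → HasDoubleDescent (filterᵇ p (x ∷ w))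
  keep-there x h with p x
  ... | true  = there h
  ... | false = h

  dd-of-descent : ∀ {n} (g : Fin n → ℕ) → Descent g → HasDoubleDescent (filterᵇ p (tabulate g))
  dd-of-descent g (descent zero (suc Q) (suc R) kP nQ nR dQ dR) with p (g zero)
  ... | true  = let L , eq = filter-first-next (g ∘ suc) (next-zero⇒first nQ) (next-pred nR)
                in subst (λ w → HasDoubleDescent (g zero ∷ w)) (sym eq) (here dQ dR)
  ... | false = ⊥-elim kP
  dd-of-descent g (descent (suc P) (suc Q) (suc R) kP nQ nR dQ dR) =
    keep-there (g zero) (dd-of-descent (g ∘ suc) (descent P Q R kP (next-pred nQ) (next-pred nR) dQ dR))
  dd-of-descent g (descent zero    zero    _    _ (next () _ _) _ _ _)
  dd-of-descent g (descent (suc _) zero    _    _ (next () _ _) _ _ _)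
  dd-of-descent g (descent _       (suc _) zero _ _ (next () _ _) _ _)

letter : ∀ {n} → Perm n → Fin n → ℕ
letter σ i = suc (toℕ (σ ⟨$⟩ʳ i))

record Obstruction {n} (σ : Perm n) : Set where
  constructor obstruction
  field
    P Q R : Fin n
    P<Q   : P <ᶠ Q
    Q<R   : Q <ᶠ R
    descQ : σ ⟨$⟩ʳ Q <ᶠ σ ⟨$⟩ʳ P
    descR : σ ⟨$⟩ʳ R <ᶠ σ ⟨$⟩ʳ Q
    above : ∀ x → P <ᶠ x → x <ᶠ R → x ≢ Q → σ ⟨$⟩ʳ P <ᶠ σ ⟨$⟩ʳ x

module _ {n} (σ : Perm n) where

  -- A double descent among the letters ≤ k is an obstruction: the letters
  -- skipped between the three descending ones exceed k, which bounds the letter at P.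
  obstruction-of-dd : ∀ k → HasDoubleDescent (restrict k (word σ)) → Obstruction σ
  obstruction-of-dd k h =
    obstruction P Q R (Next.i<j nextQ) (Next.i<j nextR) (s≤s⁻¹ descQ) (s≤s⁻¹ descR) above
    where
    open Kept (λ x → x <ᵇ suc k)
    open Descent (descent-of-dd (letter σ) h)

    skipped-above-P : ∀ x → ¬ T (letter σ x <ᵇ suc k) → σ ⟨$⟩ʳ P <ᶠ σ ⟨$⟩ʳ x
    skipped-above-P x ¬kept =
      ≤-trans (s≤s⁻¹ (<ᵇ⇒< _ (suc k) keptP)) (s≤s⁻¹ (≮⇒≥ (¬kept ∘ <⇒<ᵇ)))

    above : ∀ x → P <ᶠ x → x <ᶠ R → x ≢ Q → σ ⟨$⟩ʳ P <ᶠ σ ⟨$⟩ʳ x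
    above x P<x x<R x≢Q with <ᶠ-cmp x Q
    ... | tri< x<Q _ _ = skipped-above-P x (Next.between nextQ x P<x x<Q)
    ... | tri≈ _ x≡Q _ = ⊥-elim (x≢Q x≡Q)
    ... | tri> _ _ Q<x = skipped-above-P x (Next.between nextR x Q<x x<R)

  dd-of-obstruction : (o : Obstruction σ) →
    HasDoubleDescent (restrict (letter σ (Obstruction.P o)) (word σ))
  dd-of-obstruction (obstruction P Q R P<Q Q<R descQ descR above) =
    dd-of-descent (letter σ)
      (descent P Q R (kept-if ≤-refl)
        (next P<Q (kept-if (<⇒≤ descQ))
          λ x P<x x<Q → dropped-if (above x P<x (<ᶠ-trans x<Q Q<R) (<⇒≢ x<Q)))
        (next Q<R (kept-if (<⇒≤ (<ᶠ-trans descR descQ)))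
          λ x Q<x x<R → dropped-if (above x (<ᶠ-trans P<Q Q<x) x<R (<⇒≢ Q<x ∘ sym)))
        (s≤s descQ) (s≤s descR))
    where
    open Kept (λ x → x <ᵇ suc (letter σ P))

    kept-if : ∀ {x} → toℕ (σ ⟨$⟩ʳ x) ≤ toℕ (σ ⟨$⟩ʳ P) → T (letter σ x <ᵇ suc (letter σ P))
    kept-if le = <⇒<ᵇ (s≤s (s≤s le))

    dropped-if : ∀ {x} → σ ⟨$⟩ʳ P <ᶠ σ ⟨$⟩ʳ x → ¬ T (letter σ x <ᵇ suc (letter σ P))
    dropped-if lt t = <⇒≱ lt (s≤s⁻¹ (s≤s⁻¹ (<ᵇ⇒< _ _ t)))

  simsun⇒unobstructed : Simsun σ → ¬ Obstruction σ
  simsun⇒unobstructed sim o = sim _ (dd-of-obstruction o)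

  unobstructed⇒simsun : ¬ Obstruction σ → Simsun σ
  unobstructed⇒simsun unobstructed k h = unobstructed (obstruction-of-dd k h)

by-evaluation : ∀ {m n} → T (m <ᵇ n) → m < n
by-evaluation {m} {n} = <ᵇ⇒< m n

refuted-by-evaluation : ∀ {m n} → T (n ≤ᵇ m) → ¬ m < n
refuted-by-evaluation {m} {n} t m<n = <⇒≱ m<n (≤ᵇ⇒≤ n m t)

occurrence : ∀ {n t} (σ : Perm n) (ω : Fin t → ℕ) → (∀ a b → ω a ≡ ω b → a ≡ b) →
  (ι : Fin t → Fin n) → (∀ a b → a <ᶠ b → ι a <ᶠ ι b) →
  (∀ a b → ω a < ω b → σ ⟨$⟩ʳ ι a <ᶠ σ ⟨$⟩ʳ ι b) → Contains σ ω
occurrence σ ω ω-injective ι monotone ordered = ι , monotone , λ a b → mk⇔ (reflected a b) (ordered a b)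
  where
  reflected : ∀ a b → σ ⟨$⟩ʳ ι a <ᶠ σ ⟨$⟩ʳ ι b → ω a < ω b
  reflected a b lt with <-cmp (ω a) (ω b)
  ... | tri< ωa<ωb _ _ = ωa<ωb
  ... | tri≈ _ ωa≡ωb _ = ⊥-elim (<ᶠ-irrefl (cong (λ c → σ ⟨$⟩ʳ ι c) (ω-injective a b ωa≡ωb)) lt)
  ... | tri> _ _ ωb<ωa = ⊥-elim (<ᶠ-asym lt (ordered b a ωb<ωa))

triple : ∀ {n} → Fin n → Fin n → Fin n → Fin 3 → Fin n
triple i j l zero             = i
triple i j l (suc zero)       = j
triple i j l (suc (suc zero)) = l

triple-monotone : ∀ {n} {i j l : Fin n} → i <ᶠ j → j <ᶠ l →
  ∀ a b → a <ᶠ b → triple i j l a <ᶠ triple i j l b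
triple-monotone i<j j<l zero       (suc zero)       _ = i<j
triple-monotone i<j j<l zero       (suc (suc zero)) _ = <ᶠ-trans i<j j<l
triple-monotone i<j j<l (suc zero) (suc (suc zero)) _ = j<l
triple-monotone _ _ _                zero       ()
triple-monotone _ _ (suc _)          (suc zero) (s≤s ())
triple-monotone _ _ (suc (suc zero)) (suc (suc zero)) (s≤s (s≤s ()))

p312-injective : ∀ a b → p312 a ≡ p312 b → a ≡ b
p312-injective zero             zero             _ = refl
p312-injective (suc zero)       (suc zero)       _ = refl
p312-injective (suc (suc zero)) (suc (suc zero)) _ = refl
p312-injective zero             (suc zero)       ()
p312-injective zero             (suc (suc zero)) ()
p312-injective (suc zero)       zero             ()
p312-injective (suc zero)       (suc (suc zero)) ()
p312-injective (suc (suc zero)) zero             ()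
p312-injective (suc (suc zero)) (suc zero)       ()

p231-injective : ∀ a b → p231 a ≡ p231 b → a ≡ b
p231-injective zero             zero             _ = refl
p231-injective (suc zero)       (suc zero)       _ = refl
p231-injective (suc (suc zero)) (suc (suc zero)) _ = refl
p231-injective zero             (suc zero)       ()
p231-injective zero             (suc (suc zero)) ()
p231-injective (suc zero)       zero             ()
p231-injective (suc zero)       (suc (suc zero)) ()
p231-injective (suc (suc zero)) zero             ()
p231-injective (suc (suc zero)) (suc zero)       ()

Occurs312 : ∀ {n} → Perm n → Fin n → Fin n → Fin n → Set
Occurs312 σ i j l = i <ᶠ j × j <ᶠ l × σ ⟨$⟩ʳ j <ᶠ σ ⟨$⟩ʳ l × σ ⟨$⟩ʳ l <ᶠ σ ⟨$⟩ʳ i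

Occurs231 : ∀ {n} → Perm n → Fin n → Fin n → Fin n → Set
Occurs231 σ i j l = i <ᶠ j × j <ᶠ l × σ ⟨$⟩ʳ l <ᶠ σ ⟨$⟩ʳ i × σ ⟨$⟩ʳ i <ᶠ σ ⟨$⟩ʳ j

module _ {n} (σ : Perm n) where

  occurs312⇒contains : ∀ {i j l} → Occurs312 σ i j l → Contains σ p312
  occurs312⇒contains {i} {j} {l} (i<j , j<l , σj<σl , σl<σi) =
    occurrence σ p312 p312-injective (triple i j l) (triple-monotone i<j j<l) ordered
    where
    ordered : ∀ a b → p312 a < p312 b → σ ⟨$⟩ʳ triple i j l a <ᶠ σ ⟨$⟩ʳ triple i j l b
    ordered (suc zero)       zero             _ = <ᶠ-trans σj<σl σl<σi
    ordered (suc zero)       (suc (suc zero)) _ = σj<σl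
    ordered (suc (suc zero)) zero             _ = σl<σi
    ordered zero             zero             h = ⊥-elim (refuted-by-evaluation _ h)
    ordered zero             (suc zero)       h = ⊥-elim (refuted-by-evaluation _ h)
    ordered zero             (suc (suc zero)) h = ⊥-elim (refuted-by-evaluation _ h)
    ordered (suc zero)       (suc zero)       h = ⊥-elim (refuted-by-evaluation _ h)
    ordered (suc (suc zero)) (suc zero)       h = ⊥-elim (refuted-by-evaluation _ h)
    ordered (suc (suc zero)) (suc (suc zero)) h = ⊥-elim (refuted-by-evaluation _ h)

  occurs231⇒contains : ∀ {i j l} → Occurs231 σ i j l → Contains σ p231
  occurs231⇒contains {i} {j} {l} (i<j , j<l , σl<σi , σi<σj) =
    occurrence σ p231 p231-injective (triple i j l) (triple-monotone i<j j<l) ordered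
    where
    ordered : ∀ a b → p231 a < p231 b → σ ⟨$⟩ʳ triple i j l a <ᶠ σ ⟨$⟩ʳ triple i j l b
    ordered zero             (suc zero)       _ = σi<σj
    ordered (suc (suc zero)) zero             _ = σl<σi
    ordered (suc (suc zero)) (suc zero)       _ = <ᶠ-trans σl<σi σi<σj
    ordered zero             zero             h = ⊥-elim (refuted-by-evaluation _ h)
    ordered zero             (suc (suc zero)) h = ⊥-elim (refuted-by-evaluation _ h)
    ordered (suc zero)       zero             h = ⊥-elim (refuted-by-evaluation _ h)
    ordered (suc zero)       (suc zero)       h = ⊥-elim (refuted-by-evaluation _ h)
    ordered (suc zero)       (suc (suc zero)) h = ⊥-elim (refuted-by-evaluation _ h)
    ordered (suc (suc zero)) (suc (suc zero)) h = ⊥-elim (refuted-by-evaluation _ h)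

  contains⇒occurs312 : Contains σ p312 → ∃ λ i → ∃₂ λ j l → Occurs312 σ i j l
  contains⇒occurs312 (ι , monotone , iff) =
    ι zero , ι (suc zero) , ι (suc (suc zero)) ,
    monotone _ _ (by-evaluation _) , monotone _ _ (by-evaluation _) ,
    Equivalence.from (iff (suc zero) (suc (suc zero))) (by-evaluation _) ,
    Equivalence.from (iff (suc (suc zero)) zero) (by-evaluation _)

  contains⇒occurs231 : Contains σ p231 → ∃ λ i → ∃₂ λ j l → Occurs231 σ i j l
  contains⇒occurs231 (ι , monotone , iff) =
    ι zero , ι (suc zero) , ι (suc (suc zero)) ,
    monotone _ _ (by-evaluation _) , monotone _ _ (by-evaluation _) ,
    Equivalence.from (iff (suc (suc zero)) zero) (by-evaluation _) ,
    Equivalence.from (iff zero (suc zero)) (by-evaluation _)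

  inv-after : ∀ {x y} → x <ᶠ y → inv σ ⟨$⟩ʳ (σ ⟨$⟩ʳ x) <ᶠ inv σ ⟨$⟩ʳ (σ ⟨$⟩ʳ y)
  inv-after = subst₂ _<ᶠ_ (sym (inverseˡ σ)) (sym (inverseˡ σ))

  occurs312-inv : ∀ {i j l} → Occurs312 σ i j l →
    Occurs231 (inv σ) (σ ⟨$⟩ʳ j) (σ ⟨$⟩ʳ l) (σ ⟨$⟩ʳ i)
  occurs312-inv (i<j , j<l , σj<σl , σl<σi) = σj<σl , σl<σi , inv-after i<j , inv-after j<l

  occurs231-inv : ∀ {i j l} → Occurs231 σ i j l →
    Occurs312 (inv σ) (σ ⟨$⟩ʳ l) (σ ⟨$⟩ʳ i) (σ ⟨$⟩ʳ j)
  occurs231-inv (i<j , j<l , σl<σi , σi<σj) = σl<σi , σi<σj , inv-after i<j , inv-after j<l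

avoids312⇒inv-avoids231 : ∀ {n} (σ : Perm n) → Avoids σ p312 → Avoids (inv σ) p231
avoids312⇒inv-avoids231 σ avoids c =
  let _ , _ , _ , occ = contains⇒occurs231 (inv σ) c
  in avoids (occurs312⇒contains σ (occurs231-inv (inv σ) occ))

avoids231⇒inv-avoids312 : ∀ {n} (τ : Perm n) → Avoids τ p231 → Avoids (inv τ) p312
avoids231⇒inv-avoids312 τ avoids c =
  let _ , _ , _ , occ = contains⇒occurs312 (inv τ) c
  in avoids (occurs231⇒contains τ (occurs312-inv (inv τ) occ))

-- The key step: if σ avoids 312, an obstruction P < Q < R of σ⁻¹ gives the
-- obstruction C < B < A of σ at the positions C = σ⁻¹(R), B = σ⁻¹(Q), A = σ⁻¹(P).
-- A position y strictly between C and A, y ≠ B, must have σ(y) > R: a value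
-- σ(y) ∈ (P, R) other than Q would lie in the gap of σ⁻¹ and force y > A, and a
-- value σ(y) < P would complete a 312 with C, B (if y < B) or with B, A (if y > B).
module _ {n} (σ : Perm n) (avoids : Avoids σ p312) where

  obstruction-inverse : Obstruction (inv σ) → Obstruction σ
  obstruction-inverse (obstruction P Q R P<Q Q<R τQ<τP τR<τQ gap) =
    obstruction C B A τR<τQ τQ<τP σB<σC σA<σB above
    where
    A B C : Fin n
    A = σ ⟨$⟩ˡ P
    B = σ ⟨$⟩ˡ Q
    C = σ ⟨$⟩ˡ R

    σB<σC : σ ⟨$⟩ʳ B <ᶠ σ ⟨$⟩ʳ C
    σB<σC = subst₂ _<ᶠ_ (sym (inverseʳ σ)) (sym (inverseʳ σ)) Q<R

    σA<σB : σ ⟨$⟩ʳ A <ᶠ σ ⟨$⟩ʳ B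
    σA<σB = subst₂ _<ᶠ_ (sym (inverseʳ σ)) (sym (inverseʳ σ)) P<Q

    position : ∀ {y v} → σ ⟨$⟩ʳ y ≡ v → y ≡ σ ⟨$⟩ˡ v
    position e = trans (sym (inverseˡ σ)) (cong (σ ⟨$⟩ˡ_) e)

    right-of-A : ∀ y → P <ᶠ σ ⟨$⟩ʳ y → σ ⟨$⟩ʳ y <ᶠ R → σ ⟨$⟩ʳ y ≢ Q → A <ᶠ y
    right-of-A y P<σy σy<R σy≢Q = subst (A <ᶠ_) (inverseˡ σ) (gap (σ ⟨$⟩ʳ y) P<σy σy<R σy≢Q)

    above-R : ∀ y → C <ᶠ y → y <ᶠ A → y ≢ B → R <ᶠ σ ⟨$⟩ʳ y
    above-R y C<y y<A y≢B with <ᶠ-cmp (σ ⟨$⟩ʳ y) R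
    ... | tri> _ _ R<σy = R<σy
    ... | tri≈ _ σy≡R _ = ⊥-elim (<⇒≢ C<y (sym (position σy≡R)))
    ... | tri< σy<R _ _ with <ᶠ-cmp (σ ⟨$⟩ʳ y) P
    ...   | tri≈ _ σy≡P _ = ⊥-elim (<⇒≢ y<A (position σy≡P))
    ...   | tri> _ _ P<σy = ⊥-elim (<ᶠ-asym y<A (right-of-A y P<σy σy<R (y≢B ∘ position)))
    ...   | tri< σy<P _ _ with <ᶠ-cmp y B
    ...     | tri≈ _ y≡B _ = ⊥-elim (y≢B y≡B)
    ...     | tri< y<B _ _ = ⊥-elim (avoids (occurs312⇒contains σ
                               (C<y , y<B , subst (σ ⟨$⟩ʳ y <ᶠ_) (sym (inverseʳ σ)) (<ᶠ-trans σy<P P<Q) , σB<σC)))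
    ...     | tri> _ _ B<y = ⊥-elim (avoids (occurs312⇒contains σ
                               (B<y , y<A , subst (σ ⟨$⟩ʳ y <ᶠ_) (sym (inverseʳ σ)) σy<P , σA<σB)))

    above : ∀ y → C <ᶠ y → y <ᶠ A → y ≢ B → σ ⟨$⟩ʳ C <ᶠ σ ⟨$⟩ʳ y
    above y C<y y<A y≢B = subst (_<ᶠ σ ⟨$⟩ʳ y) (sym (inverseʳ σ)) (above-R y C<y y<A y≢B)

  inverse-simsun : Simsun σ → Simsun (inv σ)
  inverse-simsun simsun =
    unobstructed⇒simsun (inv σ) (simsun⇒unobstructed σ simsun ∘ obstruction-inverse)

inv-injective : ∀ {n} {σ τ : Perm n} → inv σ ≈ₚ inv τ → σ ≈ₚ τ
inv-injective {σ = σ} {τ} e i = begin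
  σ ⟨$⟩ʳ i                         ≡⟨ cong (σ ⟨$⟩ʳ_) (sym (trans (e (τ ⟨$⟩ʳ i)) (inverseˡ τ))) ⟩
  σ ⟨$⟩ʳ (σ ⟨$⟩ˡ (τ ⟨$⟩ʳ i))    ≡⟨ inverseʳ σ ⟩
  τ ⟨$⟩ʳ i                         ∎
  where open ≡-Reasoning

lemma4p4 : ∀ (n : ℕ) → n ≥ 1 →
    -- (i) DRS_n(312) = RS_n(312)
    (∀ (σ : Perm n) → DRS p312 σ ⇔ RS p312 σ) ×
    -- (ii) σ ↦ σ⁻¹ is a bijection DRS_n(312) → DRS_n(231)
    ((∀ (σ : Perm n) → DRS p312 σ → DRS p231 (inv σ)) ×
     (∀ (σ τ : Perm n) → DRS p312 σ → DRS p312 τ → inv σ ≈ₚ inv τ → σ ≈ₚ τ) ×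
     (∀ (τ : Perm n) → DRS p231 τ → ∃ λ (σ : Perm n) → DRS p312 σ × (inv σ ≈ₚ τ)))
lemma4p4 n _ =
  (λ σ → mk⇔ proj₁ λ { rs@(simsun , avoids) → rs , inverse-simsun σ avoids simsun }) ,
  (λ σ → λ { ((simsun , avoids) , simsun⁻¹) →
               (simsun⁻¹ , avoids312⇒inv-avoids231 σ avoids) , simsun }) ,
  (λ σ τ _ _ → inv-injective {σ = σ} {τ}) ,
  (λ τ → λ { ((simsun , avoids) , simsun⁻¹) →
               inv τ , ((simsun⁻¹ , avoids231⇒inv-avoids312 τ avoids) , simsun) , λ _ → refl })
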